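{- Let $(\Gamma,N)$ and $(\Gamma',N')$ be equivalent link-regular numbered graphs, with automata transition maps $\delta$ and $\delta'$ respectively, and let $\Sigma$ and $\Sigma'$ be powered cliques of $(\Gamma,N)$ and $(\Gamma',N')$ with $P(\Sigma)=P(\Sigma')$. Then there is a bijection $\Phi:V\Gamma\to V\Gamma'$ such that for every $v\in V\Gamma$: $P(\delta(\Sigma,v))=P(\delta'(\Sigma',\Phi(v)))$ and $P(\delta(\Sigma,v^{ -1}))=P(\delta'(\Sigma',\Phi(v)^{ -1}))$, where an equality $P(\delta(\cdot))=P(\delta'(\cdot))$ is understood to mean that either both transitions go to the reject state or both go to powered cliques with equal power profiles.
   Context: A numbered graph $(\Gamma,N)$ is a finite simplicial graph with $N:V\Gamma\to\{2,3,\dots\}$; $\mathrm{NGP}(\Gamma,N)$ has generators $v\in V\Gamma$ with $v^{N(v)}=1$ and $uv=vu$ for adjacent $u,v$, and standard generating set $V\Gamma\cup(V\Gamma)^{ -1}$ ($v^{ -1}=v$ if $N(v)=2$). Cliques, $\mathrm{Lk}$, multisets $N(U)$, link-regularity and equivalence: a clique is a vertex set spanning a complete subgraph, $\mathrm{Lk}(\sigma)=\{v\notin\sigma\mid\sigma\cup\{v\}\text{ clique}\}$, $N(U)=\{N(v)\mid v\in U\}$ as a multiset; $(\Gamma,N)$ is link-regular if $N(\sigma_1)=N(\sigma_2)\Rightarrow N(\mathrm{Lk}(\sigma_1))=N(\mathrm{Lk}(\sigma_2))$ for cliques; link-regular $(\Gamma,N),(\Gamma',N')$ are equivalent if $N(V\Gamma)=N'(V\Gamma')$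 and $N(\sigma)=N'(\sigma')\Rightarrow N(\mathrm{Lk}(\sigma))=N'(\mathrm{Lk}(\sigma'))$ for cliques $\sigma\subseteq V\Gamma,\sigma'\subseteq V\Gamma'$. A powered clique is $\Sigma:V\Gamma\to\mathbb{Z}$ with clique support $\mathrm{supp}\,\Sigma=\{v\mid\Sigma(v)\neq0\}$, $0\le\Sigma(v)\le1$ if $N(v)=2$, else $|\Sigma(v)|\le\lfloor N(v)/2\rfloor$. Its power profile is the multiset $P(\Sigma)=\{(\Sigma(v),N(v))\mid v\in\mathrm{supp}\,\Sigma\}$. The transition map $\delta$ on powered cliques: if $0\le\Sigma(v)<\lfloor N(v)/2\rfloor$, $\delta(\Sigma,v)$ is the powered clique with support $(\mathrm{supp}\,\Sigma\cap\mathrm{Lk}(v))\cup\{v\}$, equal to $\Sigma$ on $\mathrm{Lk}(v)$ and to $\Sigma(v)+1$ at $v$; if $N(v)\ne2$ and $-\lfloor N(v)/2\rfloor<\Sigma(v)\le0$, $\delta(\Sigma,v^{ -1})$ is defined the same way with $\Sigma(v)-1$ at $v$; otherwise $\delta(\Sigma,v^{\pm1})$ is a reject state $q_{\mathrm{rej}}$. $\delta'$ is defined analogously for $(\Gamma',N')$. -}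

module Defs where

open import Data.Bool using (Bool; true; false; _∧_; _∨_; not; if_then_else_; T)
open import Data.Nat as ℕ using (ℕ; _≤_)
open import Data.Nat.DivMod using (_/_)
open import Data.Integer as ℤ using (ℤ; +_; -_; ∣_∣)
open import Data.Fin using (Fin; _≟_)
open import Data.Fin.Subset using (Subset; ⁅_⁆; _∪_)
open import Data.Vec using (lookup; tabulate)
open import Data.List using (List; map; filter; allFin)
open import Data.Bool.ListAction using (all)
open import Data.List.Relation.Binary.Permutation.Propositional using (_↭_)
open import Data.Product using (_×_; _,_)
open import Data.Maybe using (Maybe; just; nothing)
open import Data.Unit using (⊤)
open import Data.Empty using (⊥)
open import Relation.Nullary.Decidable using (⌊_⌋; does)
open import Relation.Binary.PropositionalEquality using (_≡_; _≢_)
open import Function.Bundles using (_⤖_; Bijection)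
import Data.Fin as F
import Data.Nat as N

record NumberedGraph : Set where
  field
    n      : ℕ
    adj    : Fin n → Fin n → Bool
    adj-sym    : ∀ u v → adj u v ≡ adj v u
    adj-irrefl : ∀ v → adj v v ≡ false
    N      : Fin n → ℕ
    N≥2    : ∀ v → 2 ≤ N v

module _ (G : NumberedGraph) where
  open NumberedGraph G

  members : Subset n → List (Fin n)
  members U = filter (λ v → lookup U v Data.Bool.≟ true) (allFin n)

  isCliqueᵇ : Subset n → Bool
  isCliqueᵇ σ = all (λ u → all (λ v → not (lookup σ u) ∨ not (lookup σ v)
                                       ∨ does (u ≟ v) ∨ adj u v)
                               (allFin n)) (allFin n)

  IsClique : Subset n → Set
  IsClique σ = T (isCliqueᵇ σ)

  Lk : Subset n → Subset n
  Lk σ = tabulate (λ v → not (lookup σ v) ∧ isCliqueᵇ (σ ∪ ⁅ v ⁆))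

  -- the multiset N(U), as a list (compared up to permutation _↭_)
  NMS : Subset n → List ℕ
  NMS U = map N (members U)

  full : Subset n
  full = tabulate (λ _ → true)

  LinkRegular : Set
  LinkRegular = ∀ σ₁ σ₂ → IsClique σ₁ → IsClique σ₂ →
                NMS σ₁ ↭ NMS σ₂ → NMS (Lk σ₁) ↭ NMS (Lk σ₂)

  supp : (Fin n → ℤ) → Subset n
  supp Σ = tabulate (λ v → not ⌊ Σ v ℤ.≟ + 0 ⌋)

  record PoweredClique : Set where
    field
      fn        : Fin n → ℤ
      supp-clique : IsClique (supp fn)
      bound-2   : ∀ v → N v ≡ 2 → (+ 0 ℤ.≤ fn v) × (fn v ℤ.≤ + 1)
      bound-≠2  : ∀ v → N v ≢ 2 → ∣ fn v ∣ ≤ N v / 2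

  -- power profile P(Σ) = {(Σ(v), N(v)) | v ∈ supp Σ}, as a list up to _↭_
  profile : (Fin n → ℤ) → List (ℤ × ℕ)
  profile Σ = map (λ v → (Σ v , N v)) (members (supp Σ))

  -- letters of the standard generating set: v (plus) or v⁻¹ (minus)
  data Sign : Set where
    plus minus : Sign

  -- the powered clique with support (supp Σ ∩ Lk(v)) ∪ {v}, equal to Σ
  -- on Lk(v) and to k at v
  update : (Fin n → ℤ) → Fin n → ℤ → (Fin n → ℤ)
  update Σ v k u =
    if does (u ≟ v) then k
    else if lookup (Lk ⁅ v ⁆) u then Σ u else + 0

  -- transition map; nothing = reject state q_rej
  δ : PoweredClique → Fin n → Sign → Maybe (Fin n → ℤ)
  δ Σ v plus =
    if ⌊ + 0 ℤ.≤? s ⌋ ∧ ⌊ s ℤ.<? + (N v / 2) ⌋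
    then just (update f v (s ℤ.+ + 1)) else nothing
    where f = PoweredClique.fn Σ
          s = f v
  δ Σ v minus =
    if not ⌊ N v N.≟ 2 ⌋ ∧ ⌊ - + (N v / 2) ℤ.<? s ⌋ ∧ ⌊ s ℤ.≤? + 0 ⌋
    then just (update f v (s ℤ.- + 1)) else nothing
    where f = PoweredClique.fn Σ
          s = f v

open NumberedGraph

Equivalent : NumberedGraph → NumberedGraph → Set
Equivalent G G' =
  NMS G (full G) ↭ NMS G' (full G') ×
  (∀ σ σ' → IsClique G σ → IsClique G' σ' →
     NMS G σ ↭ NMS G' σ' → NMS G (Lk G σ) ↭ NMS G' (Lk G' σ'))

SameOutcome : (G G' : NumberedGraph) → Maybe (Fin (n G) → ℤ) → Maybe (Fin (n G') → ℤ) → Set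
SameOutcome G G' nothing  nothing  = ⊤
SameOutcome G G' (just f) (just g) = profile G f ↭ profile G' g
SameOutcome G G' _        _        = ⊥

-- Enumerate the support of Σ as e₁, …, e_k. Equal power profiles give a matching of the two supports
-- preserving (Σ(v), N(v)), so the support of Σ′ can be enumerated as e′₁, …, e′_k compatibly. Give each vertex v
-- the key (Σ(v), N(v), (v adjacent to e_i)ᵢ). Whether δ(Σ, v^{±1}) rejects, and the power profile it produces
-- otherwise, depend only on the key of v, so it suffices to show that every key is carried by equally many
-- vertices of Γ and of Γ′: the bijection Φ then matches vertices with equal keys.
--
-- On the supports this is the matching itself. Off the supports, count the vertices of number m that are adjacent
-- to e_i for i ∈ A and non-adjacent to e_i for i ∈ B. Splitting on one more position is additive, so by induction
-- on |B| it suffices to treat B = ∅; and those counts are read off N(Lk σ_A) for the clique σ_A = {e_i | i ∈ A},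
-- since Lk σ_A consists of the e_i with i ∉ A and the vertices off the support adjacent to all of σ_A. Equivalence
-- of the graphs transfers N(Lk σ_A) from Γ to Γ′, because N(σ_A) = N(σ′_A).

module Submission where

open import Defs
open import Algebra.Bundles using (CommutativeMonoid)
import Algebra.Properties.CommutativeSemigroup as CommutativeSemigroupProperties
open import Data.Bool using (Bool; true; false; _∧_; _∨_; not; if_then_else_; T)
import Data.Bool as Bool
open import Data.Bool.Properties
  using (T-≡; ∧-zeroʳ; ∧-comm; ∧-conicalˡ; ∨-zeroʳ; ∨-identityʳ; not-injective; ∧-commutativeMonoid)
open import Data.Empty using (⊥-elim)
open import Data.Fin using (Fin; zero; suc; punchIn; punchOut)
import Data.Fin as Fin
open import Data.Fin.Permutation using (Permutation; _⟨$⟩ʳ_; _⟨$⟩ˡ_; inverseˡ; inverseʳ; insert; insert-punchIn)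
import Data.Fin.Permutation as Permutation
open import Data.Fin.Properties
  using (any?; suc-injective; punchInᵢ≢i; punchIn-punchOut; punchOut-punchIn; punchOut-cong; punchOut-injective)
open import Data.Fin.Subset using (Subset; ⁅_⁆; _∪_)
open import Data.Integer as ℤ using (ℤ; 0ℤ)
open import Data.List using (List; []; _∷_; _++_; allFin)
import Data.List as List
open import Data.List.Membership.Propositional using (_∈_)
open import Data.List.Membership.Propositional.Properties using (∈-∃++)
open import Data.List.Relation.Binary.Permutation.Propositional using (_↭_; ↭-refl; ↭-prep; ↭-sym; ↭-trans)
open import Data.List.Relation.Binary.Permutation.Propositional.Properties using (↭-length; filter-↭; shift)
open import Data.List.Relation.Unary.All.Properties using (all⁺; all⁻; tabulate⁺; tabulate⁻)
open import Data.List.Relation.Unary.Any using (here; there)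
open import Data.Maybe using (Maybe; just; nothing)
open import Data.Nat as ℕ using (ℕ; zero; suc; _+_; _<_; _/_; s≤s; z≤n)
open import Data.Nat.Properties using (+-suc; +-cancelˡ-≡; +-commutativeSemigroup)
import Data.Nat.Properties as ℕ
open import Data.Product using (Σ-syntax; ∃; _×_; _,_; proj₁; proj₂)
open import Data.Product.Properties using (,-injective)
open import Data.Unit using (tt)
open import Data.Vec using (Vec; []; _∷_; lookup; tabulate; map; _[_]≔_)
open import Data.Vec.Properties
  using (lookup∘tabulate; lookup-zipWith; lookup-replicate; tabulate-cong; []≔-lookup; ≡-dec)
open import Function using (_∘_; id)
open import Function.Bundles using (_⤖_; Bijection; Equivalence; mk⇔)
open import Function.Definitions using (Injective)
open import Function.Properties.Inverse using (↔⇒⤖)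
open import Relation.Binary.PropositionalEquality
open import Relation.Binary.Structures using (IsDecEquivalence)
open import Relation.Binary.TypeClasses using (_≟_)
open import Relation.Nullary using (Dec; does; yes; no)
open import Relation.Nullary.Decidable using (⌊_⌋; dec-true; dec-false; dec-no; does-⇔; _×-dec_)
open import Data.Bool.Instances
open import Data.Fin.Instances
open import Data.Integer.Instances
open import Data.Nat.Instances
open import Data.Product.Instances
open import Data.Vec.Instances

open CommutativeSemigroupProperties +-commutativeSemigroup using () renaming (x∙yz≈y∙xz to m+[n+o]≡n+[m+o])
open CommutativeSemigroupProperties (CommutativeMonoid.commutativeSemigroup ∧-commutativeMonoid)
  using () renaming (x∙yz≈y∙xz to a∧[b∧c]≡b∧[a∧c])

true≢false : true ≢ false
true≢false ()

does-true⇒ : ∀ {P : Set} (p? : Dec P) → does p? ≡ true → P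
does-true⇒ (yes p) _ = p

true⇔true⇒≡ : ∀ {a b : Bool} → (a ≡ true → b ≡ true) → (b ≡ true → a ≡ true) → a ≡ b
true⇔true⇒≡ {true}  {true}  _ _ = refl
true⇔true⇒≡ {true}  {false} a⇒b _ = sym (a⇒b refl)
true⇔true⇒≡ {false} {true}  _ b⇒a = b⇒a refl
true⇔true⇒≡ {false} {false} _ _ = refl

indicator : Bool → ℕ
indicator true  = 1
indicator false = 0

count : ∀ {n} → (Fin n → Bool) → ℕ
count {zero}  p = 0
count {suc n} p = indicator (p zero) + count (p ∘ suc)

count-cong : ∀ {n} {p q : Fin n → Bool} → (∀ i → p i ≡ q i) → count p ≡ count q
count-cong {zero}  p≗q = refl
count-cong {suc n} p≗q = cong₂ _+_ (cong indicator (p≗q zero)) (count-cong (p≗q ∘ suc))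

count-all-false : ∀ {n} (p : Fin n → Bool) → (∀ i → p i ≡ false) → count p ≡ 0
count-all-false {zero}  p p≡false = refl
count-all-false {suc n} p p≡false rewrite p≡false zero = count-all-false (p ∘ suc) (p≡false ∘ suc)

count-const-∧ : ∀ {n} b (p : Fin n → Bool) → count (λ i → b ∧ p i) ≡ (if b then count p else 0)
count-const-∧ true  p = refl
count-const-∧ {n} false p = count-all-false {n} _ (λ _ → refl)

count-punchIn : ∀ {n} (p : Fin (suc n) → Bool) (w : Fin (suc n)) →
                count p ≡ indicator (p w) + count (p ∘ punchIn w)
count-punchIn p       zero    = refl
count-punchIn {suc n} p (suc w) = begin
  indicator (p zero) + count (p ∘ suc)
    ≡⟨ cong (indicator (p zero) +_) (count-punchIn (p ∘ suc) w) ⟩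
  indicator (p zero) + (indicator (p (suc w)) + count (p ∘ suc ∘ punchIn w))
    ≡⟨ m+[n+o]≡n+[m+o] (indicator (p zero)) (indicator (p (suc w))) _ ⟩
  indicator (p (suc w)) + (indicator (p zero) + count (p ∘ suc ∘ punchIn w))
    ∎
  where open ≡-Reasoning

count-except : ∀ {n} (p q : Fin n → Bool) w → (∀ {u} → u ≢ w → p u ≡ q u) →
               indicator (q w) + count p ≡ indicator (p w) + count q
count-except {suc n} p q w p≡q = begin
  indicator (q w) + count p
    ≡⟨ cong (indicator (q w) +_) (count-punchIn p w) ⟩
  indicator (q w) + (indicator (p w) + count (p ∘ punchIn w))
    ≡⟨ m+[n+o]≡n+[m+o] (indicator (q w)) (indicator (p w)) _ ⟩
  indicator (p w) + (indicator (q w) + count (p ∘ punchIn w))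
    ≡⟨ cong (λ c → indicator (p w) + (indicator (q w) + c)) (count-cong (p≡q ∘ punchInᵢ≢i w)) ⟩
  indicator (p w) + (indicator (q w) + count (q ∘ punchIn w))
    ≡⟨ cong (indicator (p w) +_) (count-punchIn q w) ⟨
  indicator (p w) + count q
    ∎
  where open ≡-Reasoning

count-split : ∀ {n} (p q : Fin n → Bool) →
              count p ≡ count (λ i → q i ∧ p i) + count (λ i → not (q i) ∧ p i)
count-split {zero}  p q = refl
count-split {suc n} p q with q zero | p zero | count-split (p ∘ suc) (q ∘ suc)
... | true  | false | ih = ih
... | false | false | ih = ih
... | true  | true  | ih = cong suc ih
... | false | true  | ih = trans (cong suc ih) (sym (+-suc _ _))

count-positive : ∀ {n} (p : Fin n → Bool) → 0 < count p → ∃ λ i → p i ≡ true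
count-positive {suc n} p pos with p zero in p0
... | true  = zero , p0
... | false with i , pi ← count-positive (p ∘ suc) pos = suc i , pi

count-reindex : ∀ {k n} (e : Fin k → Fin n) → Injective _≡_ _≡_ e → (p : Fin n → Bool) →
                (∀ u → p u ≡ true → ∃ λ i → e i ≡ u) → count p ≡ count (p ∘ e)
count-reindex {zero} e e-inj p covers = count-all-false p p≡false
  where
  p≡false : ∀ u → p u ≡ false
  p≡false u with p u in pu
  ... | true with () , _ ← covers u pu
  ... | false = refl
count-reindex {suc k} {zero}  e e-inj p covers with () ← e zero
count-reindex {suc k} {suc n} e e-inj p covers =
  trans (count-punchIn p (e zero))
        (cong (indicator (p (e zero)) +_)
              (trans (count-reindex e′ e′-inj (p ∘ punchIn (e zero)) covers′)
                     (count-cong (λ i → cong p (punchIn-punchOut (e0≢ i))))))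
  where
  e0≢ : ∀ i → e zero ≢ e (suc i)
  e0≢ i eq with () ← e-inj eq
  e′ : Fin k → Fin n
  e′ i = punchOut (e0≢ i)
  e′-inj : Injective _≡_ _≡_ e′
  e′-inj eq = suc-injective (e-inj (punchOut-injective (e0≢ _) (e0≢ _) eq))
  covers′ : ∀ u → p (punchIn (e zero) u) ≡ true → ∃ λ i → e′ i ≡ u
  covers′ u pu with covers _ pu
  ... | zero  , eq = ⊥-elim (punchInᵢ≢i (e zero) u (sym eq))
  ... | suc i , eq = i , trans (punchOut-cong (e zero) eq) (punchOut-punchIn (e zero))

module _ {A : Set} {{_ : IsDecEquivalence {A = A} _≡_}} where

  _==_ : A → A → Bool
  x == a = does (x ≟ a)

  ==-refl : ∀ x → x == x ≡ true
  ==-refl x = dec-true (x ≟ x) refl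

  ==⇒≡ : ∀ {x a} → x == a ≡ true → x ≡ a
  ==⇒≡ {x} {a} = does-true⇒ (x ≟ a)

  multiplicity : A → List A → ℕ
  multiplicity a xs = List.length (List.filter (_≟ a) xs)

  multiplicity-∷ : ∀ a x xs → multiplicity a (x ∷ xs) ≡ indicator (x == a) + multiplicity a xs
  multiplicity-∷ a x xs with x == a
  ... | true  = refl
  ... | false = refl

  ↭⇒multiplicity≡ : ∀ {xs ys} → xs ↭ ys → ∀ a → multiplicity a xs ≡ multiplicity a ys
  ↭⇒multiplicity≡ xs↭ys a = ↭-length (filter-↭ (_≟ a) xs↭ys)

  multiplicity-head : ∀ x xs → 0 < multiplicity x (x ∷ xs)
  multiplicity-head x xs rewrite multiplicity-∷ x x xs | ==-refl x = s≤s z≤n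

  multiplicity-positive⇒∈ : ∀ a ys → 0 < multiplicity a ys → a ∈ ys
  multiplicity-positive⇒∈ a (y ∷ ys) pos with y ≟ a
  ... | yes refl = here refl
  ... | no  _    = there (multiplicity-positive⇒∈ a ys pos)

  multiplicity≡⇒↭ : ∀ xs ys → (∀ a → multiplicity a xs ≡ multiplicity a ys) → xs ↭ ys
  multiplicity≡⇒↭ []       []       same = ↭-refl
  multiplicity≡⇒↭ []       (y ∷ ys) same with () ← subst (0 <_) (sym (same y)) (multiplicity-head y ys)
  multiplicity≡⇒↭ (x ∷ xs) ys       same
    with zs₁ , zs₂ , refl ← ∈-∃++ (multiplicity-positive⇒∈ x ys (subst (0 <_) (same x) (multiplicity-head x xs))) =
    ↭-trans (↭-prep x (multiplicity≡⇒↭ xs (zs₁ ++ zs₂) same′)) (↭-sym (shift x zs₁ zs₂))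
    where
    same′ : ∀ a → multiplicity a xs ≡ multiplicity a (zs₁ ++ zs₂)
    same′ a = +-cancelˡ-≡ (indicator (x == a)) _ _ (begin
      indicator (x == a) + multiplicity a xs  ≡⟨ multiplicity-∷ a x xs ⟨
      multiplicity a (x ∷ xs)                 ≡⟨ same a ⟩
      multiplicity a (zs₁ ++ x ∷ zs₂)         ≡⟨ ↭⇒multiplicity≡ (shift x zs₁ zs₂) a ⟩
      multiplicity a (x ∷ zs₁ ++ zs₂)         ≡⟨ multiplicity-∷ a x (zs₁ ++ zs₂) ⟩
      indicator (x == a) + multiplicity a (zs₁ ++ zs₂) ∎)
      where open ≡-Reasoning

  multiplicity-map-filter : ∀ {n} (U : Fin n → Bool) (h : Fin n → A) a →
    multiplicity a (List.map h (List.filter (λ v → U v Bool.≟ true) (allFin n))) ≡ count (λ v → U v ∧ h v == a)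
  multiplicity-map-filter {n} U h a = go id
    where
    go : ∀ {m} (g : Fin m → Fin n) →
         multiplicity a (List.map h (List.filter (λ v → U v Bool.≟ true) (List.tabulate g))) ≡
         count (λ i → U (g i) ∧ h (g i) == a)
    go {zero}  g = refl
    go {suc m} g with U (g zero)
    ... | true  = trans (multiplicity-∷ a (h (g zero)) _) (cong (indicator (h (g zero) == a) +_) (go (g ∘ suc)))
    ... | false = go (g ∘ suc)

  fibre-of-zero-nonempty : ∀ {m} (f : Fin (suc m) → A) → 0 < count (λ i → f i == f zero)
  fibre-of-zero-nonempty f rewrite ==-refl (f zero) = s≤s z≤n

  fibres⇒permutation : ∀ {m n} (f : Fin m → A) (g : Fin n → A) →
                       (∀ a → count (λ i → f i == a) ≡ count (λ j → g j == a)) →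
                       Σ[ π ∈ Permutation m n ] (∀ i → g (π ⟨$⟩ʳ i) ≡ f i)
  fibres⇒permutation {zero}  {zero}  f g same = Permutation.id , λ ()
  fibres⇒permutation {zero}  {suc n} f g same
    with () ← subst (0 <_) (sym (same (g zero))) (fibre-of-zero-nonempty g)
  fibres⇒permutation {suc m} {zero}  f g same
    with () ← subst (0 <_) (same (f zero)) (fibre-of-zero-nonempty f)
  fibres⇒permutation {suc m} {suc n} f g same
    with w , gw==f0 ← count-positive (λ j → g j == f zero) (subst (0 <_) (same (f zero)) (fibre-of-zero-nonempty f)) =
    insert zero w π , preserves
    where
    same′ : ∀ a → count (λ i → f (suc i) == a) ≡ count (λ j → g (punchIn w j) == a)
    same′ a = +-cancelˡ-≡ (indicator (f zero == a)) _ _ (trans (same a)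
                (trans (count-punchIn (λ j → g j == a) w) (cong (λ x → indicator (x == a) + _) (==⇒≡ gw==f0))))
    π′ : Σ[ π ∈ Permutation m n ] (∀ i → g (punchIn w (π ⟨$⟩ʳ i)) ≡ f (suc i))
    π′ = fibres⇒permutation (f ∘ suc) (g ∘ punchIn w) same′
    π : Permutation m n
    π = proj₁ π′
    preserves : ∀ i → g (insert zero w π ⟨$⟩ʳ i) ≡ f i
    preserves zero    = ==⇒≡ gw==f0
    preserves (suc i) = trans (cong g (insert-punchIn zero w π i)) (proj₂ π′ i)

module _ {A B : Set} {{_ : IsDecEquivalence {A = A} _≡_}} {{_ : IsDecEquivalence {A = B} _≡_}} where

  ==-× : ∀ (a a′ : A) (b b′ : B) → ((a , b) == (a′ , b′)) ≡ (a == a′) ∧ (b == b′)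
  ==-× a a′ b b′ =
    does-⇔ (mk⇔ ,-injective (λ { (refl , refl) → refl })) ((a , b) ≟ (a′ , b′)) (a ≟ a′ ×-dec b ≟ b′)

Pattern : ℕ → Set
Pattern = Vec (Maybe Bool)

fits : Maybe Bool → Bool → Bool
fits nothing      _ = true
fits (just true)  c = c
fits (just false) c = not c

matches : ∀ {k} → Pattern k → Vec Bool k → Bool
matches []        []       = true
matches (x ∷ pat) (c ∷ cs) = fits x c ∧ matches pat cs

matches-≔ : ∀ {k} (pat : Pattern k) j x cs →
            matches (pat [ j ]≔ x) cs ≡ fits x (lookup cs j) ∧ matches (pat [ j ]≔ nothing) cs
matches-≔ (y ∷ pat) zero    x (c ∷ cs) = refl
matches-≔ (y ∷ pat) (suc j) x (c ∷ cs) =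
  trans (cong (fits y c ∧_) (matches-≔ pat j x cs)) (a∧[b∧c]≡b∧[a∧c] (fits y c) (fits x (lookup cs j)) _)

falses : ∀ {k} → Pattern k → ℕ
falses []                = 0
falses (just false ∷ pat) = suc (falses pat)
falses (just true  ∷ pat) = falses pat
falses (nothing    ∷ pat) = falses pat

positive : ∀ {k} → Vec Bool k → Pattern k
positive = map (λ b → if b then just true else nothing)

falses≡0⇒positive : ∀ {k} (pat : Pattern k) → falses pat ≡ 0 → ∃ λ A → pat ≡ positive A
falses≡0⇒positive []                 _    = [] , refl
falses≡0⇒positive (just true  ∷ pat) none with A , refl ← falses≡0⇒positive pat none = true ∷ A , refl
falses≡0⇒positive (nothing    ∷ pat) none with A , refl ← falses≡0⇒positive pat none = false ∷ A , refl

falses≡suc⇒false : ∀ {k r} (pat : Pattern k) → falses pat ≡ suc r → ∃ λ j → lookup pat j ≡ just false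
falses≡suc⇒false (just false ∷ pat) _    = zero , refl
falses≡suc⇒false (just true  ∷ pat) some with j , pj ← falses≡suc⇒false pat some = suc j , pj
falses≡suc⇒false (nothing    ∷ pat) some with j , pj ← falses≡suc⇒false pat some = suc j , pj

falses-≔ : ∀ {k} (pat : Pattern k) j {x} → lookup pat j ≡ just false → x ≢ just false →
           suc (falses (pat [ j ]≔ x)) ≡ falses pat
falses-≔ (_ ∷ pat) zero {nothing}     refl _  = refl
falses-≔ (_ ∷ pat) zero {just true}   refl _  = refl
falses-≔ (_ ∷ pat) zero {just false}  refl x≢ = ⊥-elim (x≢ refl)
falses-≔ (just false ∷ pat) (suc j) pj x≢ = cong suc (falses-≔ pat j pj x≢)
falses-≔ (just true  ∷ pat) (suc j) pj x≢ = falses-≔ pat j pj x≢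
falses-≔ (nothing    ∷ pat) (suc j) pj x≢ = falses-≔ pat j pj x≢

module _ {k} (C C′ : Pattern k → ℕ)
  (split  : ∀ pat j → C  (pat [ j ]≔ nothing) ≡ C  (pat [ j ]≔ just true) + C  (pat [ j ]≔ just false))
  (split′ : ∀ pat j → C′ (pat [ j ]≔ nothing) ≡ C′ (pat [ j ]≔ just true) + C′ (pat [ j ]≔ just false))
  (agree-on-positive : ∀ A → C (positive A) ≡ C′ (positive A)) where

  agree-on-positive⇒agree : ∀ pat → C pat ≡ C′ pat
  agree-on-positive⇒agree pat = go (falses pat) pat refl
    where
    go : ∀ r pat → falses pat ≡ r → C pat ≡ C′ pat
    go zero    pat none with A , refl ← falses≡0⇒positive pat none = agree-on-positive A
    go (suc r) pat some with j , pj ← falses≡suc⇒false pat some =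
      subst (λ p → C p ≡ C′ p) (trans (cong (pat [ j ]≔_) (sym pj)) ([]≔-lookup pat j))
        (+-cancelˡ-≡ (C (pat [ j ]≔ just true)) _ _ (begin
          C (pat [ j ]≔ just true) + C (pat [ j ]≔ just false)   ≡⟨ split pat j ⟨
          C (pat [ j ]≔ nothing)                                 ≡⟨ go r _ (fewer (λ ())) ⟩
          C′ (pat [ j ]≔ nothing)                                ≡⟨ split′ pat j ⟩
          C′ (pat [ j ]≔ just true) + C′ (pat [ j ]≔ just false) ≡⟨ cong (_+ _) (go r _ (fewer (λ ()))) ⟨
          C (pat [ j ]≔ just true) + C′ (pat [ j ]≔ just false)  ∎))
      where
      open ≡-Reasoning
      fewer : ∀ {x} → x ≢ just false → falses (pat [ j ]≔ x) ≡ r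
      fewer x≢ = ℕ.suc-injective (trans (falses-≔ pat j pj x≢) some)

matches-exact : ∀ {k} (bs cs : Vec Bool k) → matches (map just bs) cs ≡ does (≡-dec Bool._≟_ cs bs)
matches-exact []            []           = refl
matches-exact (true  ∷ bs) (true  ∷ cs) = matches-exact bs cs
matches-exact (true  ∷ bs) (false ∷ cs) = refl
matches-exact (false ∷ bs) (true  ∷ cs) = refl
matches-exact (false ∷ bs) (false ∷ cs) = matches-exact bs cs

matches-positive⁺ : ∀ {k} (A cs : Vec Bool k) → (∀ i → lookup A i ≡ true → lookup cs i ≡ true) →
                    matches (positive A) cs ≡ true
matches-positive⁺ []          []       _  = refl
matches-positive⁺ (true  ∷ A) (c ∷ cs) A⊆cs rewrite A⊆cs zero refl = matches-positive⁺ A cs (A⊆cs ∘ suc)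
matches-positive⁺ (false ∷ A) (c ∷ cs) A⊆cs = matches-positive⁺ A cs (A⊆cs ∘ suc)

matches-positive⁻ : ∀ {k} (A cs : Vec Bool k) → matches (positive A) cs ≡ true →
                    ∀ i → lookup A i ≡ true → lookup cs i ≡ true
matches-positive⁻ (true  ∷ A) (true ∷ cs) m zero    _  = refl
matches-positive⁻ (true  ∷ A) (true ∷ cs) m (suc i) Ai = matches-positive⁻ A cs m i Ai
matches-positive⁻ (false ∷ A) (c ∷ cs)    m (suc i) Ai = matches-positive⁻ A cs m i Ai

lookup-⁅⁆ : ∀ {n} (u x : Fin n) → lookup ⁅ u ⁆ x ≡ does (x Fin.≟ u)
lookup-⁅⁆ zero    zero    = refl
lookup-⁅⁆ zero    (suc x) = lookup-replicate x false
lookup-⁅⁆ (suc u) zero    = refl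
lookup-⁅⁆ (suc u) (suc x) with x Fin.≟ u | lookup-⁅⁆ u x
... | yes _ | eq = eq
... | no  _ | eq = eq

module _ (G : NumberedGraph) where
  open NumberedGraph G

  clique⇒adjacent : ∀ σ {u v} → IsClique G σ → lookup σ u ≡ true → lookup σ v ≡ true → u ≢ v →
                    adj u v ≡ true
  clique⇒adjacent σ {u} {v} clique σu σv u≢v =
    Equivalence.to T-≡ (subst T pair-ok (tabulate⁻ (all⁺ _ (allFin n) (tabulate⁻ (all⁺ _ (allFin n) clique) u)) v))
    where
    pair-ok : (not (lookup σ u) ∨ not (lookup σ v) ∨ does (u Fin.≟ v) ∨ adj u v) ≡ adj u v
    pair-ok rewrite σu | σv | dec-false (u Fin.≟ v) u≢v = refl

  adjacent⇒clique : ∀ σ → (∀ {u v} → lookup σ u ≡ true → lookup σ v ≡ true → u ≢ v → adj u v ≡ true) →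
                    IsClique G σ
  adjacent⇒clique σ adjacent = all⁻ _ (tabulate⁺ λ u → all⁻ _ (tabulate⁺ (pair-ok u)))
    where
    pair-ok : ∀ u v → T (not (lookup σ u) ∨ not (lookup σ v) ∨ does (u Fin.≟ v) ∨ adj u v)
    pair-ok u v with lookup σ u in σu | lookup σ v in σv | u Fin.≟ v
    ... | false | _     | _       = _
    ... | true  | false | _       = _
    ... | true  | true  | yes _   = _
    ... | true  | true  | no  u≢v = Equivalence.from T-≡ (adjacent σu σv u≢v)

  lookup-∪⁅⁆ : ∀ (σ : Subset n) u x → lookup (σ ∪ ⁅ u ⁆) x ≡ lookup σ x ∨ does (x Fin.≟ u)
  lookup-∪⁅⁆ σ u x = trans (lookup-zipWith _∨_ x σ ⁅ u ⁆) (cong (lookup σ x ∨_) (lookup-⁅⁆ u x))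

  lookup-Lk : ∀ σ u → lookup (Lk G σ) u ≡ not (lookup σ u) ∧ isCliqueᵇ G (σ ∪ ⁅ u ⁆)
  lookup-Lk σ u = lookup∘tabulate _ u

  link⁻ : ∀ σ {u} → lookup (Lk G σ) u ≡ true →
          lookup σ u ≡ false × (∀ {w} → lookup σ w ≡ true → adj w u ≡ true)
  link⁻ σ {u} u∈Lk with lookup σ u in σu | trans (sym (lookup-Lk σ u)) u∈Lk
  ... | false | clique = refl , λ {w} σw →
    clique⇒adjacent (σ ∪ ⁅ u ⁆) (Equivalence.from T-≡ clique)
      (trans (lookup-∪⁅⁆ σ u w) (cong (_∨ _) σw))
      (trans (lookup-∪⁅⁆ σ u u) (trans (cong (lookup σ u ∨_) (dec-true (u Fin.≟ u) refl)) (∨-zeroʳ _)))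
      (λ { refl → true≢false (trans (sym σw) σu) })

  link⁺ : ∀ σ {u} → IsClique G σ → lookup σ u ≡ false → (∀ {w} → lookup σ w ≡ true → adj w u ≡ true) →
          lookup (Lk G σ) u ≡ true
  link⁺ σ {u} clique σu adjacent =
    trans (lookup-Lk σ u) (trans (cong (λ b → not b ∧ isCliqueᵇ G (σ ∪ ⁅ u ⁆)) σu)
                                 (Equivalence.to T-≡ (adjacent⇒clique (σ ∪ ⁅ u ⁆) adjacent′)))
    where
    in-σ : ∀ {x} → lookup (σ ∪ ⁅ u ⁆) x ≡ true → x ≢ u → lookup σ x ≡ true
    in-σ {x} x∈ x≢u = trans (sym (∨-identityʳ _)) (trans (cong (lookup σ x ∨_) (sym (dec-false (x Fin.≟ u) x≢u)))
                        (trans (sym (lookup-∪⁅⁆ σ u x)) x∈))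
    adjacent′ : ∀ {x y} → lookup (σ ∪ ⁅ u ⁆) x ≡ true → lookup (σ ∪ ⁅ u ⁆) y ≡ true → x ≢ y → adj x y ≡ true
    adjacent′ {x} {y} x∈ y∈ x≢y with x Fin.≟ u | y Fin.≟ u
    ... | yes refl | yes refl = ⊥-elim (x≢y refl)
    ... | yes refl | no y≢u   = trans (adj-sym x y) (adjacent (in-σ y∈ y≢u))
    ... | no x≢u   | yes refl = adjacent (in-σ x∈ x≢u)
    ... | no x≢u   | no y≢u   = clique⇒adjacent σ clique (in-σ x∈ x≢u) (in-σ y∈ y≢u) x≢y

  link-⁅⁆ : ∀ v u → lookup (Lk G ⁅ v ⁆) u ≡ adj u v
  link-⁅⁆ v u = true⇔true⇒≡
    (λ u∈Lk → trans (adj-sym u v) (proj₂ (link⁻ ⁅ v ⁆ u∈Lk) (v∈⁅v⁆)))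
    (λ adj-uv → link⁺ ⁅ v ⁆ singleton-clique (u∉⁅v⁆ adj-uv) λ w∈ →
      subst (λ x → adj x u ≡ true) (sym (∈⁅v⁆ w∈)) (trans (adj-sym v u) adj-uv))
    where
    v∈⁅v⁆ : lookup ⁅ v ⁆ v ≡ true
    v∈⁅v⁆ = trans (lookup-⁅⁆ v v) (dec-true (v Fin.≟ v) refl)
    ∈⁅v⁆ : ∀ {w} → lookup ⁅ v ⁆ w ≡ true → w ≡ v
    ∈⁅v⁆ {w} w∈ with w Fin.≟ v | lookup-⁅⁆ v w
    ... | yes w≡v | _  = w≡v
    ... | no  _   | eq with () ← trans (sym w∈) eq
    singleton-clique : IsClique G ⁅ v ⁆
    singleton-clique = adjacent⇒clique ⁅ v ⁆ λ x∈ y∈ x≢y → ⊥-elim (x≢y (trans (∈⁅v⁆ x∈) (sym (∈⁅v⁆ y∈))))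
    u∉⁅v⁆ : adj u v ≡ true → lookup ⁅ v ⁆ u ≡ false
    u∉⁅v⁆ adj-uv =
      trans (lookup-⁅⁆ v u) (dec-false (u Fin.≟ v) λ { refl → true≢false (trans (sym adj-uv) (adj-irrefl u)) })

record Enumeration {n} (p : Fin n → Bool) : Set where
  field
    size      : ℕ
    at        : Fin size → Fin n
    injective : Injective _≡_ _≡_ at
    member    : ∀ i → p (at i) ≡ true
    complete  : ∀ u → p u ≡ true → ∃ λ i → at i ≡ u

  count-along : (q : Fin n → Bool) → (∀ u → q u ≡ true → p u ≡ true) → count q ≡ count (q ∘ at)
  count-along q q⊆p = count-reindex at injective q (λ u → complete u ∘ q⊆p u)

enumerate : ∀ {n} (p : Fin n → Bool) → Enumeration p
enumerate {zero}  p = record { size = 0 ; at = λ () ; injective = λ {} ; member = λ () ; complete = λ () }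
enumerate {suc n} p with enumerate (p ∘ suc) | p zero in p0
... | E | false = record
  { size = size ; at = suc ∘ at ; injective = injective ∘ suc-injective ; member = member ; complete = complete′ }
  where
  open Enumeration E
  complete′ : ∀ u → p u ≡ true → ∃ λ i → suc (at i) ≡ u
  complete′ zero    pu with () ← trans (sym p0) pu
  complete′ (suc u) pu with i , refl ← complete u pu = i , refl
... | E | true = record
  { size = suc size ; at = at′ ; injective = injective′ ; member = member′ ; complete = complete′ }
  where
  open Enumeration E
  at′ : Fin (suc size) → Fin (suc n)
  at′ zero    = zero
  at′ (suc i) = suc (at i)
  injective′ : Injective _≡_ _≡_ at′
  injective′ {zero}  {zero}  _  = refl
  injective′ {suc i} {suc j} eq = cong suc (injective (suc-injective eq))
  member′ : ∀ i → p (at′ i) ≡ true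
  member′ zero    = p0
  member′ (suc i) = member i
  complete′ : ∀ u → p u ≡ true → ∃ λ i → at′ i ≡ u
  complete′ zero    _  = zero , refl
  complete′ (suc u) pu with i , refl ← complete u pu = suc i , refl

reorder : ∀ {n k} {p : Fin n → Bool} (E : Enumeration p) → Permutation k (Enumeration.size E) → Enumeration p
reorder E π = record
  { size = _
  ; at = at ∘ (π ⟨$⟩ʳ_)
  ; injective = λ eq → trans (sym (inverseˡ π)) (trans (cong (π ⟨$⟩ˡ_) (injective eq)) (inverseˡ π))
  ; member = member ∘ (π ⟨$⟩ʳ_)
  ; complete = λ u pu → let i , at-i≡u = complete u pu in π ⟨$⟩ˡ i , trans (cong at (inverseʳ π)) at-i≡u
  }
  where open Enumeration E

Key : ℕ → Set
Key k = ℤ × ℕ × Vec Bool k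

lookup-supp : ∀ G (f : Fin (NumberedGraph.n G) → ℤ) u → lookup (supp G f) u ≡ not ⌊ f u ℤ.≟ 0ℤ ⌋
lookup-supp G f u = lookup∘tabulate _ u

module Support (G : NumberedGraph) (Σ : PoweredClique G) (E : Enumeration (lookup (supp G (PoweredClique.fn Σ)))) where
  open NumberedGraph G
  open PoweredClique Σ
  open Enumeration E using (injective; member; count-along)

  k : ℕ
  k = Enumeration.size E

  e : Fin k → Fin n
  e = Enumeration.at E

  S : Subset n
  S = supp G fn

  bits : Fin n → Vec Bool k
  bits v = tabulate (λ i → adj v (e i))

  key : Fin n → Key k
  key v = fn v , N v , bits v

  label : Fin k → ℤ × ℕ
  label i = fn (e i) , N (e i)

  outside⇒0 : ∀ {u} → lookup S u ≡ false → fn u ≡ 0ℤ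
  outside⇒0 {u} u∉S with fn u ℤ.≟ 0ℤ | lookup-supp G fn u
  ... | yes fu≡0 | _  = fu≡0
  ... | no  _    | eq = ⊥-elim (true≢false (trans (sym eq) u∉S))

  count-on-S : ∀ q → count (λ v → lookup S v ∧ q v) ≡ count (q ∘ e)
  count-on-S q = trans (count-along _ (λ u → ∧-conicalˡ _ _))
                       (count-cong (λ i → cong (_∧ q (e i)) (member i)))

  adj-on-S : ∀ i j → adj (e i) (e j) ≡ not (i == j)
  adj-on-S i j with i ≟ j
  ... | yes refl = adj-irrefl (e i)
  ... | no  i≢j  = clique⇒adjacent G S supp-clique (member i) (member j) (i≢j ∘ injective)

  key-on-S : ∀ i → key (e i) ≡ (fn (e i) , N (e i) , tabulate (λ j → not (i == j)))
  key-on-S i = cong (λ bs → fn (e i) , N (e i) , bs) (tabulate-cong (adj-on-S i))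

  profile-multiplicity : ∀ κ → multiplicity κ (profile G fn) ≡ count (λ i → label i == κ)
  profile-multiplicity κ = trans (multiplicity-map-filter (lookup S) (λ v → fn v , N v) κ) (count-on-S _)

  outside : ℕ → Pattern k → ℕ
  outside m pat = count (λ v → not (lookup S v) ∧ (N v == m ∧ matches pat (bits v)))

  outside-split : ∀ m pat j →
    outside m (pat [ j ]≔ nothing) ≡ outside m (pat [ j ]≔ just true) + outside m (pat [ j ]≔ just false)
  outside-split m pat j =
    trans (count-split _ (λ v → lookup (bits v) j)) (cong₂ _+_ (count-cong (fix (just true))) (count-cong (fix (just false))))
    where
    fix : ∀ x v → fits x (lookup (bits v) j) ∧ (not (lookup S v) ∧ (N v == m ∧ matches (pat [ j ]≔ nothing) (bits v))) ≡
                  not (lookup S v) ∧ (N v == m ∧ matches (pat [ j ]≔ x) (bits v))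
    fix x v = begin
      c ∧ (a ∧ (b ∧ M))   ≡⟨ a∧[b∧c]≡b∧[a∧c] c a (b ∧ M) ⟩
      a ∧ (c ∧ (b ∧ M))   ≡⟨ cong (a ∧_) (a∧[b∧c]≡b∧[a∧c] c b M) ⟩
      a ∧ (b ∧ (c ∧ M))   ≡⟨ cong (λ y → a ∧ (b ∧ y)) (matches-≔ pat j x (bits v)) ⟨
      a ∧ (b ∧ matches (pat [ j ]≔ x) (bits v)) ∎
      where
      open ≡-Reasoning
      a b c M : Bool
      a = not (lookup S v)
      b = N v == m
      c = fits x (lookup (bits v) j)
      M = matches (pat [ j ]≔ nothing) (bits v)

  key-fibre : ∀ κ → count (λ v → key v == κ) ≡
                    count (λ i → key (e i) == κ) + count (λ v → not (lookup S v) ∧ key v == κ)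
  key-fibre κ = trans (count-split (λ v → key v == κ) (lookup S))
                      (cong (_+ count (λ v → not (lookup S v) ∧ key v == κ)) (count-on-S (λ v → key v == κ)))

  outside-key-fibre : ∀ z m bs → count (λ v → not (lookup S v) ∧ key v == (z , m , bs)) ≡
                                 (if 0ℤ == z then outside m (map just bs) else 0)
  outside-key-fibre z m bs = trans (count-cong fibre) (count-const-∧ {n} (0ℤ == z) _)
    where
    fibre : ∀ v → not (lookup S v) ∧ key v == (z , m , bs) ≡
                  (0ℤ == z) ∧ (not (lookup S v) ∧ (N v == m ∧ matches (map just bs) (bits v)))
    fibre v with lookup S v in v∈S
    ... | true  = sym (∧-zeroʳ _)
    ... | false rewrite ==-× (fn v) z (N v , bits v) (m , bs) | ==-× (N v) m (bits v) bs
                      | outside⇒0 v∈S | matches-exact bs (bits v) = refl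

  spanned : Vec Bool k → Subset n
  spanned A = tabulate (λ u → does (any? λ i → (lookup A i Bool.≟ true) ×-dec (e i ≟ u)))

  selected unselected : Vec Bool k → ℕ → ℕ
  selected   A m = count (λ i → lookup A i ∧ N (e i) == m)
  unselected A m = count (λ i → not (lookup A i) ∧ N (e i) == m)

  module _ (A : Vec Bool k) where

    spanned⁻ : ∀ {u} → lookup (spanned A) u ≡ true → ∃ λ i → lookup A i ≡ true × e i ≡ u
    spanned⁻ {u} u∈ = does-true⇒ (any? _) (trans (sym (lookup∘tabulate _ u)) u∈)

    spanned-at : ∀ i → lookup (spanned A) (e i) ≡ lookup A i
    spanned-at i = true⇔true⇒≡
      (λ ei∈ → let j , Aj , ej≡ei = spanned⁻ ei∈ in subst (λ x → lookup A x ≡ true) (injective ej≡ei) Aj)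
      (λ Ai → trans (lookup∘tabulate _ (e i)) (dec-true (any? _) (i , Ai , refl)))

    spanned⊆S : ∀ {u} → lookup (spanned A) u ≡ true → lookup S u ≡ true
    spanned⊆S u∈ with i , _ , refl ← spanned⁻ u∈ = member i

    spanned-clique : IsClique G (spanned A)
    spanned-clique = adjacent⇒clique G (spanned A) λ u∈ v∈ →
      clique⇒adjacent G S supp-clique (spanned⊆S u∈) (spanned⊆S v∈)

    spanned-multiplicity : ∀ m → multiplicity m (NMS G (spanned A)) ≡ selected A m
    spanned-multiplicity m = begin
      multiplicity m (NMS G (spanned A))                       ≡⟨ multiplicity-map-filter (lookup (spanned A)) N m ⟩
      count (λ v → lookup (spanned A) v ∧ N v == m)            ≡⟨ count-along _ (λ u → spanned⊆S ∘ ∧-conicalˡ _ _) ⟩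
      count (λ i → lookup (spanned A) (e i) ∧ N (e i) == m)    ≡⟨ count-cong (λ i → cong (_∧ N (e i) == m) (spanned-at i)) ⟩
      selected A m                                             ∎
      where open ≡-Reasoning

    link-on-S : ∀ i → lookup (Lk G (spanned A)) (e i) ≡ not (lookup A i)
    link-on-S i = true⇔true⇒≡
      (λ ei∈Lk → cong not (trans (sym (spanned-at i)) (proj₁ (link⁻ G (spanned A) ei∈Lk))))
      (λ ¬Ai → link⁺ G (spanned A) spanned-clique (trans (spanned-at i) (not-injective ¬Ai)) λ w∈ →
        let j , Aj , ej≡w = spanned⁻ w∈ in
        subst (λ w → adj w (e i) ≡ true) ej≡w (trans (adj-on-S j i) (cong not (dec-false (j ≟ i) λ { refl →
          true≢false (trans (sym Aj) (not-injective ¬Ai)) }))))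

    link-off-S : ∀ {u} → lookup S u ≡ false → lookup (Lk G (spanned A)) u ≡ matches (positive A) (bits u)
    link-off-S {u} u∉S = true⇔true⇒≡
      (λ u∈Lk → matches-positive⁺ A (bits u) λ i Ai →
        trans (lookup∘tabulate _ i) (trans (adj-sym u (e i)) (proj₂ (link⁻ G (spanned A) u∈Lk) (trans (spanned-at i) Ai))))
      (λ fits-u → link⁺ G (spanned A) spanned-clique u∉spanned λ w∈ →
        let j , Aj , ej≡w = spanned⁻ w∈ in
        subst (λ w → adj w u ≡ true) ej≡w
          (trans (adj-sym (e j) u) (trans (sym (lookup∘tabulate _ j)) (matches-positive⁻ A (bits u) fits-u j Aj))))
      where
      u∉spanned : lookup (spanned A) u ≡ false
      u∉spanned with lookup (spanned A) u in u∈
      ... | true  with () ← trans (sym (spanned⊆S u∈)) u∉S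
      ... | false = refl

    link-multiplicity : ∀ m → multiplicity m (NMS G (Lk G (spanned A))) ≡ unselected A m + outside m (positive A)
    link-multiplicity m = begin
      multiplicity m (NMS G L)                                                  ≡⟨ multiplicity-map-filter (lookup L) N m ⟩
      count (λ v → lookup L v ∧ N v == m)                                       ≡⟨ count-split _ (lookup S) ⟩
      count (λ v → lookup S v ∧ (lookup L v ∧ N v == m)) +
        count (λ v → not (lookup S v) ∧ (lookup L v ∧ N v == m))                ≡⟨ cong₂ _+_ on-S off-S ⟩
      unselected A m + outside m (positive A)                                   ∎
      where
      open ≡-Reasoning
      L : Subset n
      L = Lk G (spanned A)
      on-S : count (λ v → lookup S v ∧ (lookup L v ∧ N v == m)) ≡ unselected A m
      on-S = trans (count-on-S _) (count-cong (λ i → cong (_∧ N (e i) == m) (link-on-S i)))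
      off-S : count (λ v → not (lookup S v) ∧ (lookup L v ∧ N v == m)) ≡ outside m (positive A)
      off-S = count-cong off-S-at
        where
        off-S-at : ∀ v → not (lookup S v) ∧ (lookup L v ∧ N v == m) ≡
                         not (lookup S v) ∧ (N v == m ∧ matches (positive A) (bits v))
        off-S-at v with lookup S v in v∈S
        ... | true  = refl
        ... | false = trans (cong (_∧ N v == m) (link-off-S v∈S)) (∧-comm (matches (positive A) (bits v)) (N v == m))

  update-multiplicity : ∀ v z → z ≢ 0ℤ → ∀ κ →
    multiplicity κ (profile G (update G fn v z)) ≡ indicator ((z , N v) == κ) + count (λ i → adj (e i) v ∧ label i == κ)
  update-multiplicity v z z≢0 κ = begin
    multiplicity κ (profile G f)                  ≡⟨ multiplicity-map-filter (lookup (supp G f)) (λ u → f u , N u) κ ⟩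
    count P                                       ≡⟨ cong (_+ count P) (cong indicator Q-at-v) ⟩
    indicator (Q v) + count P                     ≡⟨ count-except P Q v P≡Q ⟩
    indicator (P v) + count Q                     ≡⟨ cong₂ _+_ (cong indicator P-at-v) (count-on-S _) ⟩
    indicator ((z , N v) == κ) + count (λ i → adj (e i) v ∧ label i == κ) ∎
    where
    open ≡-Reasoning
    f : Fin n → ℤ
    f = update G fn v z
    P Q : Fin n → Bool
    P u = lookup (supp G f) u ∧ (f u , N u) == κ
    Q u = lookup S u ∧ (adj u v ∧ (fn u , N u) == κ)
    P-at-v : P v ≡ (z , N v) == κ
    P-at-v rewrite lookup-supp G f v | dec-true (v Fin.≟ v) refl | dec-no (z ℤ.≟ 0ℤ) z≢0 = refl
    Q-at-v : false ≡ Q v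
    Q-at-v rewrite adj-irrefl v = sym (∧-zeroʳ (lookup S v))
    P≡Q : ∀ {u} → u ≢ v → P u ≡ Q u
    P≡Q {u} u≢v rewrite lookup-supp G f u | dec-false (u Fin.≟ v) u≢v | link-⁅⁆ G v u with adj u v
    ... | true  = cong (_∧ (fn u , N u) == κ) (sym (lookup-supp G fn u))
    ... | false = sym (∧-zeroʳ (lookup S u))

plus-allowed⇒≢0 : ∀ m s → ⌊ 0ℤ ℤ.≤? s ⌋ ∧ ⌊ s ℤ.<? ℤ.+ (m / 2) ⌋ ≡ true → s ℤ.+ ℤ.+ 1 ≢ 0ℤ
plus-allowed⇒≢0 m (ℤ.+ zero)   _ ()
plus-allowed⇒≢0 m (ℤ.+ suc _)  _ ()

minus-allowed⇒≢0 : ∀ m s → not ⌊ m ℕ.≟ 2 ⌋ ∧ ⌊ ℤ.- ℤ.+ (m / 2) ℤ.<? s ⌋ ∧ ⌊ s ℤ.≤? 0ℤ ⌋ ≡ true →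
                   s ℤ.- ℤ.+ 1 ≢ 0ℤ
minus-allowed⇒≢0 m (ℤ.+ zero)    _       ()
minus-allowed⇒≢0 m ℤ.-[1+ _ ]    _       ()
minus-allowed⇒≢0 m (ℤ.+ suc k)   allowed with ⌊ ℤ.- ℤ.+ (m / 2) ℤ.<? ℤ.+ suc k ⌋ | not ⌊ m ℕ.≟ 2 ⌋
minus-allowed⇒≢0 m (ℤ.+ suc k) () | true  | true
minus-allowed⇒≢0 m (ℤ.+ suc k) () | false | true
minus-allowed⇒≢0 m (ℤ.+ suc k) () | _     | false

module Matching (G G′ : NumberedGraph) (equivalent : Equivalent G G′)
                (Σ : PoweredClique G) (Σ′ : PoweredClique G′)
                (same-profile : profile G (PoweredClique.fn Σ) ↭ profile G′ (PoweredClique.fn Σ′)) where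
  open NumberedGraph

  fn : Fin (n G) → ℤ
  fn = PoweredClique.fn Σ

  fn′ : Fin (n G′) → ℤ
  fn′ = PoweredClique.fn Σ′

  module Γ = Support G Σ (enumerate _)
  module Γ₀′ = Support G′ Σ′ (enumerate _)

  support-matching : Σ[ π ∈ Permutation Γ.k Γ₀′.k ] (∀ i → Γ₀′.label (π ⟨$⟩ʳ i) ≡ Γ.label i)
  support-matching = fibres⇒permutation Γ.label Γ₀′.label λ κ → begin
      count (λ i → Γ.label i == κ)     ≡⟨ Γ.profile-multiplicity κ ⟨
      multiplicity κ (profile G fn)     ≡⟨ ↭⇒multiplicity≡ same-profile κ ⟩
      multiplicity κ (profile G′ fn′)   ≡⟨ Γ₀′.profile-multiplicity κ ⟩
      count (λ i → Γ₀′.label i == κ)   ∎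
    where open ≡-Reasoning

  module Γ′ = Support G′ Σ′ (reorder (enumerate _) (proj₁ support-matching))

  label-match : ∀ i → Γ′.label i ≡ Γ.label i
  label-match = proj₂ support-matching

  label-N-match : ∀ i → N G′ (Γ′.e i) ≡ N G (Γ.e i)
  label-N-match = cong proj₂ ∘ label-match

  spanned-match : ∀ A → NMS G (Γ.spanned A) ↭ NMS G′ (Γ′.spanned A)
  spanned-match A = multiplicity≡⇒↭ (NMS G (Γ.spanned A)) (NMS G′ (Γ′.spanned A)) λ m → begin
    multiplicity m (NMS G (Γ.spanned A))    ≡⟨ Γ.spanned-multiplicity A m ⟩
    Γ.selected A m                          ≡⟨ count-cong (λ i → cong (λ x → lookup A i ∧ x == m)
                                                                      (sym (label-N-match i))) ⟩
    Γ′.selected A m                         ≡⟨ Γ′.spanned-multiplicity A m ⟨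
    multiplicity m (NMS G′ (Γ′.spanned A))  ∎
    where open ≡-Reasoning

  link-match : ∀ A → NMS G (Lk G (Γ.spanned A)) ↭ NMS G′ (Lk G′ (Γ′.spanned A))
  link-match A =
    proj₂ equivalent (Γ.spanned A) (Γ′.spanned A) (Γ.spanned-clique A) (Γ′.spanned-clique A) (spanned-match A)

  outside-match : ∀ m pat → Γ.outside m pat ≡ Γ′.outside m pat
  outside-match m = agree-on-positive⇒agree (Γ.outside m) (Γ′.outside m) (Γ.outside-split m) (Γ′.outside-split m)
    λ A → +-cancelˡ-≡ (Γ.unselected A m) _ _ (begin
      Γ.unselected A m + Γ.outside m (positive A)     ≡⟨ Γ.link-multiplicity A m ⟨
      multiplicity m (NMS G (Lk G (Γ.spanned A)))     ≡⟨ ↭⇒multiplicity≡ (link-match A) m ⟩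
      multiplicity m (NMS G′ (Lk G′ (Γ′.spanned A)))  ≡⟨ Γ′.link-multiplicity A m ⟩
      Γ′.unselected A m + Γ′.outside m (positive A)   ≡⟨ cong (_+ Γ′.outside m (positive A)) (count-cong λ i →
                                                           cong (λ x → not (lookup A i) ∧ x == m) (label-N-match i)) ⟩
      Γ.unselected A m + Γ′.outside m (positive A)    ∎)
    where open ≡-Reasoning

  key-fibres : ∀ κ → count (λ v → Γ.key v == κ) ≡ count (λ v → Γ′.key v == κ)
  key-fibres κ@(z , m , bs) = begin
    count (λ v → Γ.key v == κ)
      ≡⟨ Γ.key-fibre κ ⟩
    count (λ i → Γ.key (Γ.e i) == κ) + count (λ v → not (lookup Γ.S v) ∧ Γ.key v == κ)
      ≡⟨ cong₂ _+_ on-S off-S ⟩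
    count (λ i → Γ′.key (Γ′.e i) == κ) + count (λ v → not (lookup Γ′.S v) ∧ Γ′.key v == κ)
      ≡⟨ Γ′.key-fibre κ ⟨
    count (λ v → Γ′.key v == κ)
      ∎
    where
    open ≡-Reasoning
    on-S : count (λ i → Γ.key (Γ.e i) == κ) ≡ count (λ i → Γ′.key (Γ′.e i) == κ)
    on-S = count-cong λ i → cong (_== κ) (trans (Γ.key-on-S i) (trans
             (cong (λ (z , m) → z , m , tabulate (λ j → not (i == j))) (sym (label-match i))) (sym (Γ′.key-on-S i))))
    off-S : count (λ v → not (lookup Γ.S v) ∧ Γ.key v == κ) ≡ count (λ v → not (lookup Γ′.S v) ∧ Γ′.key v == κ)
    off-S = trans (Γ.outside-key-fibre z m bs)
                  (trans (cong (λ c → if 0ℤ == z then c else 0) (outside-match m (map just bs)))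
                         (sym (Γ′.outside-key-fibre z m bs)))

  vertex-matching : Σ[ Φ ∈ Permutation (n G) (n G′) ] (∀ v → Γ′.key (Φ ⟨$⟩ʳ v) ≡ Γ.key v)
  vertex-matching = fibres⇒permutation Γ.key Γ′.key key-fibres

  module _ (v : Fin (n G)) where
    private
      v′ : Fin (n G′)
      v′ = proj₁ vertex-matching ⟨$⟩ʳ v
      key-match : Γ′.key v′ ≡ Γ.key v
      key-match = proj₂ vertex-matching v

    fn-match : fn′ v′ ≡ fn v
    fn-match = cong proj₁ key-match

    N-match : N G′ v′ ≡ N G v
    N-match = cong (proj₁ ∘ proj₂) key-match

    adj-match : ∀ i → adj G′ (Γ′.e i) v′ ≡ adj G (Γ.e i) v
    adj-match i = begin
      adj G′ (Γ′.e i) v′          ≡⟨ adj-sym G′ _ v′ ⟩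
      adj G′ v′ (Γ′.e i)          ≡⟨ lookup∘tabulate _ i ⟨
      lookup (Γ′.bits v′) i       ≡⟨ cong (λ bs → lookup bs i) (cong (proj₂ ∘ proj₂) key-match) ⟩
      lookup (Γ.bits v) i         ≡⟨ lookup∘tabulate _ i ⟩
      adj G v (Γ.e i)             ≡⟨ adj-sym G v _ ⟩
      adj G (Γ.e i) v             ∎
      where open ≡-Reasoning

    update-match : ∀ z → z ≢ 0ℤ → profile G (update G fn v z) ↭ profile G′ (update G′ fn′ v′ z)
    update-match z z≢0 = multiplicity≡⇒↭ _ _ λ κ → begin
      multiplicity κ (profile G (update G fn v z))
        ≡⟨ Γ.update-multiplicity v z z≢0 κ ⟩
      indicator ((z , N G v) == κ) + count (λ i → adj G (Γ.e i) v ∧ Γ.label i == κ)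
        ≡⟨ cong₂ _+_ (cong (λ m → indicator ((z , m) == κ)) (sym N-match))
                     (count-cong λ i → cong₂ _∧_ (sym (adj-match i)) (cong (_== κ) (sym (label-match i)))) ⟩
      indicator ((z , N G′ v′) == κ) + count (λ i → adj G′ (Γ′.e i) v′ ∧ Γ′.label i == κ)
        ≡⟨ Γ′.update-multiplicity v′ z z≢0 κ ⟨
      multiplicity κ (profile G′ (update G′ fn′ v′ z))
        ∎
      where open ≡-Reasoning

    plus-outcome : SameOutcome G G′ (δ G Σ v plus) (δ G′ Σ′ v′ plus)
    plus-outcome rewrite fn-match | N-match with ⌊ 0ℤ ℤ.≤? fn v ⌋ ∧ ⌊ fn v ℤ.<? ℤ.+ (N G v / 2) ⌋ in allowed
    ... | true  = update-match _ (plus-allowed⇒≢0 (N G v) (fn v) allowed)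
    ... | false = tt

    minus-outcome : SameOutcome G G′ (δ G Σ v minus) (δ G′ Σ′ v′ minus)
    minus-outcome rewrite fn-match | N-match
      with not ⌊ N G v ℕ.≟ 2 ⌋ ∧ ⌊ ℤ.- ℤ.+ (N G v / 2) ℤ.<? fn v ⌋ ∧ ⌊ fn v ℤ.≤? 0ℤ ⌋ in allowed
    ... | true  = update-match _ (minus-allowed⇒≢0 (N G v) (fn v) allowed)
    ... | false = tt

lemma5p11 : (G G' : NumberedGraph) → LinkRegular G → LinkRegular G' → Equivalent G G' →
    (Σ : PoweredClique G) (Σ' : PoweredClique G') →
    profile G (PoweredClique.fn Σ) ↭ profile G' (PoweredClique.fn Σ') →
    Σ[ Φ ∈ Fin (NumberedGraph.n G) ⤖ Fin (NumberedGraph.n G') ]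
    (∀ v → SameOutcome G G' (δ G Σ v plus) (δ G' Σ' (Bijection.to Φ v) plus)
    × SameOutcome G G' (δ G Σ v minus) (δ G' Σ' (Bijection.to Φ v) minus))
lemma5p11 G G′ _ _ equivalent Σ Σ′ same-profile =
  ↔⇒⤖ (proj₁ vertex-matching) , λ v → plus-outcome v , minus-outcome v
  where open Matching G G′ equivalent Σ Σ′ same-profile
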